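{- Let $d\geq 2$ and let $V$ be a finite set with $|V|\geq d+1$. Let $\mathcal{L}$ be a nonempty family of subsets of $V$ such that $|L|\in\{d,\,d+1,\,|V|-1\}$ for every $L\in\mathcal{L}$. Then the simplicial complex $\left(V,\bigcup_{L\in\mathcal{L}}\mathcal{B}_d(V,L)\right)$ is boolean representable, where $\mathcal{B}_d(V,L)=P_{\leq d}(V)\cup\{X\in P_{d+1}(V) : |X\cap L|=d\}$.
   Context: A (finite) simplicial complex is a pair $(V,\mathcal{H})$ where $V$ is a finite nonempty set and $\mathcal{H}\subseteq 2^V$ contains all singletons and is closed under taking subsets. $P_n(V)$ (resp. $P_{\leq n}(V)$) is the set of subsets of $V$ of size exactly (resp. at most) $n$. A simplicial complex $(V,\mathcal{H})$ is boolean representable if there is a boolean matrix $M$ with columns indexed by $V$ such that $\mathcal{H}$ is exactly the set of $X\subseteq V$ for which some square submatrix with column set $X$ is congruent (by permuting rows and columns) to a lower unitriangular boolean matrix. -}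

module Defs where

open import Data.Nat using (ℕ; _≤_; _<_; _+_; _∸_)
open import Data.Fin using (Fin)
open import Data.Fin.Subset using (Subset; _∈_; _∩_; ∣_∣)
open import Data.Bool using (Bool; true; false)
open import Data.Product using (Σ; ∃; _×_)
open import Data.Sum using (_⊎_)
open import Data.List using (List)
open import Data.List.Membership.Propositional using () renaming (_∈_ to _∈ₗ_)
open import Relation.Binary.PropositionalEquality using (_≡_)
open import Function.Bundles using (_⇔_)
open import Function.Definitions using (Injective)

BoolMatrix : ℕ → ℕ → Set
BoolMatrix m n = Fin m → Fin n → Bool

-- X is the column set of a square submatrix of M congruent (under row and
-- column permutations) to a lower unitriangular boolean matrix:
-- there are k rows r(0..k-1) (distinct) and an enumeration c(0..k-1) of X
-- (a bijection Fin k → X) with M(r i, c i) = 1 and M(r i, c j) = 0 for i < j.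
LowerUnitriangularCols : ∀ {m n} → BoolMatrix m n → Subset n → Set
LowerUnitriangularCols {m} {n} M X =
  Σ ℕ λ k → Σ (Fin k → Fin m) λ r → Σ (Fin k → Fin n) λ c →
    Injective _≡_ _≡_ r × Injective _≡_ _≡_ c ×
    (∀ x → (x ∈ X) ⇔ (∃ λ i → c i ≡ x)) ×
    (∀ i → M (r i) (c i) ≡ true) ×
    (∀ i j → Data.Fin._<_ i j → M (r i) (c j) ≡ false)

BooleanRepresentable : ∀ {n} → (Subset n → Set) → Set
BooleanRepresentable {n} H =
  Σ ℕ λ m → Σ (BoolMatrix m n) λ M → ∀ X → H X ⇔ LowerUnitriangularCols M X

B : ∀ {n} → ℕ → Subset n → Subset n → Set
B d L X = ∣ X ∣ ≤ d ⊎ (∣ X ∣ ≡ d + 1 × ∣ X ∩ L ∣ ≡ d)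

⋃B : ∀ {n} → ℕ → List (Subset n) → Subset n → Set
⋃B d 𝓛 X = ∃ λ L → L ∈ₗ 𝓛 × B d L X

-- Call Z ⊆ V flat if every d-subset of Z together with any point outside Z is a
-- face, while Z contains no face of size d + 1.  The representing matrix has a
-- row for every subset Z: the indicator of V ∖ Z when Z is flat, constantly 1
-- otherwise.  In a triangular submatrix with columns c₀, …, c_{k-1} the row of
-- c₀ is then a flat containing c₁, …, c_{k-1} but not c₀.  For k = d + 1 this
-- makes {c₀, …, c_d} a face; for k ≥ d + 2 the same argument one row lower
-- yields a (d+1)-face inside the flat of c₀, which is impossible.  Conversely,
-- sets of size at most d are triangular by adding one point at a time (sets of
-- size < d are flat), and a (d+1)-face X is triangular as soon as some flat
-- contains X − x but not x.  For a face of B_d(V,L) that flat is L itself, L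
-- minus a point outside X (when L is a face), or X minus a point of L (when
-- L = V minus a point).

module Submission where

open import Defs
open import Data.Bool using (true; false)
open import Data.Fin using (Fin; zero; suc)
import Data.Fin as Fin
import Data.Fin.Properties as Finₚ
open import Data.Fin.Subset
  using (Subset; inside; outside; _∈_; _∉_; _⊆_; _∩_; _∪_; _-_; ∁; ⁅_⁆; ⊥; ∣_∣; Nonempty)
open import Data.Fin.Subset.Properties
open import Data.List using (List; []; _∷_; _++_; map; length; lookup)
open import Data.List.Membership.Propositional using (find; lose) renaming (_∈_ to _∈ₗ_)
open import Data.List.Membership.Propositional.Properties using (∈-map⁺; ∈-++⁺ˡ; ∈-++⁺ʳ)
import Data.List.Relation.Unary.Any as Any
open import Data.List.Relation.Unary.Any.Properties using (lookup-index)
open import Data.Nat using (ℕ; zero; suc; _≤_; _<_; _+_; _∸_; z≤n; s≤s; s<s; s<s⁻¹; _≤?_)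
import Data.Nat.Properties as ℕₚ
open import Data.Product using (∃; ∃₂; _×_; _,_; proj₁; proj₂)
open import Data.Sum using (_⊎_; inj₁; inj₂)
open import Data.Vec.Base using ([]; _∷_; here; there)
open import Data.Vec.Functional using (head; tail)
import Data.Vec.Functional as Vector
open import Function using (_∘_)
open import Function.Bundles using (_⇔_; mk⇔; Equivalence)
open import Function.Definitions using (Injective)
open import Relation.Binary.Definitions using (tri<; tri≈; tri>)
open import Relation.Binary.PropositionalEquality
  using (_≡_; _≢_; refl; sym; trans; cong; subst; subst₂)
open import Relation.Nullary using (¬_; Dec; yes; no; does; contradiction)
open import Relation.Nullary.Decidable
  using (decidable-stable; dec-true; dec-false; ¬?; _×-dec_; _⊎-dec_; _→-dec_; map′)
open import Relation.Unary using (Decidable)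

private variable
  k n : ℕ
  p q : Subset n
  x y : Fin n

x∉p⇒∣p∪⁅x⁆∣≡1+∣p∣ : x ∉ p → ∣ p ∪ ⁅ x ⁆ ∣ ≡ suc ∣ p ∣
x∉p⇒∣p∪⁅x⁆∣≡1+∣p∣ {x = zero}  {p = inside  ∷ p} x∉p = contradiction here x∉p
x∉p⇒∣p∪⁅x⁆∣≡1+∣p∣ {x = zero}  {p = outside ∷ p} x∉p = cong (suc ∘ ∣_∣) (∪-identityʳ p)
x∉p⇒∣p∪⁅x⁆∣≡1+∣p∣ {x = suc x} {p = inside  ∷ p} x∉p =
  cong suc (x∉p⇒∣p∪⁅x⁆∣≡1+∣p∣ (x∉p ∘ there))
x∉p⇒∣p∪⁅x⁆∣≡1+∣p∣ {x = suc x} {p = outside ∷ p} x∉p = x∉p⇒∣p∪⁅x⁆∣≡1+∣p∣ (x∉p ∘ there)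

x∉p-x : ∀ (p : Subset n) x → x ∉ p - x
x∉p-x (_ ∷ p) (suc x) (there x∈p-x) = x∉p-x p x x∈p-x

x∈p-y⇒x∈p : x ∈ p - y → x ∈ p
x∈p-y⇒x∈p {p = p} {y = y} = p─q⊆p p ⁅ y ⁆

x∈p-y⇒x≢y : x ∈ p - y → x ≢ y
x∈p-y⇒x≢y {p = p} x∈p-y refl = x∉p-x p _ x∈p-y

x∈p∪⁅y⁆⁻ : x ∈ p ∪ ⁅ y ⁆ → x ∈ p ⊎ x ≡ y
x∈p∪⁅y⁆⁻ {p = p} {y = y} x∈ with x∈p∪q⁻ p ⁅ y ⁆ x∈
... | inj₁ x∈p   = inj₁ x∈p
... | inj₂ x∈⁅y⁆ = inj₂ (x∈⁅y⁆⇒x≡y y x∈⁅y⁆)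

p⊆q∧x∈q⇒p∪⁅x⁆⊆q : p ⊆ q → x ∈ q → p ∪ ⁅ x ⁆ ⊆ q
p⊆q∧x∈q⇒p∪⁅x⁆⊆q p⊆q x∈q y∈ with x∈p∪⁅y⁆⁻ y∈
... | inj₁ y∈p = p⊆q y∈p
... | inj₂ refl = x∈q

x∈p⇒p-x∪⁅x⁆≡p : x ∈ p → (p - x) ∪ ⁅ x ⁆ ≡ p
x∈p⇒p-x∪⁅x⁆≡p {x = x} {p = p} x∈p = ⊆-antisym (p⊆q∧x∈q⇒p∪⁅x⁆⊆q (p─q⊆p p ⁅ x ⁆) x∈p) p⊆
  where
  p⊆ : p ⊆ (p - x) ∪ ⁅ x ⁆
  p⊆ {y} y∈p with y Finₚ.≟ x
  ... | yes refl = x∈p∪q⁺ (inj₂ (x∈⁅x⁆ x))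
  ... | no y≢x   = x∈p∪q⁺ (inj₁ (x∈p∧x≢y⇒x∈p-y y∈p y≢x))

x∈p∧∣p∣≡1+k⇒∣p-x∣≡k : x ∈ p → ∣ p ∣ ≡ suc k → ∣ p - x ∣ ≡ k
x∈p∧∣p∣≡1+k⇒∣p-x∣≡k {x = x} {p = p} x∈p ∣p∣≡1+k = ℕₚ.suc-injective (begin
  suc ∣ p - x ∣          ≡⟨ sym (x∉p⇒∣p∪⁅x⁆∣≡1+∣p∣ (x∉p-x p x)) ⟩
  ∣ (p - x) ∪ ⁅ x ⁆ ∣    ≡⟨ cong ∣_∣ (x∈p⇒p-x∪⁅x⁆≡p x∈p) ⟩
  ∣ p ∣                  ≡⟨ ∣p∣≡1+k ⟩
  suc _                  ∎)
  where open Relation.Binary.PropositionalEquality.≡-Reasoning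

p⊆q∧∣q∣≤∣p∣⇒p≡q : p ⊆ q → ∣ q ∣ ≤ ∣ p ∣ → p ≡ q
p⊆q∧∣q∣≤∣p∣⇒p≡q {p = p} p⊆q ∣q∣≤∣p∣ = ⊆-antisym p⊆q q⊆p
  where
  q⊆p : _ ⊆ p
  q⊆p {x} x∈q = decidable-stable (x ∈? p) λ x∉p →
    ℕₚ.<⇒≱ (p⊂q⇒∣p∣<∣q∣ (p⊆q , x , x∈q , x∉p)) ∣q∣≤∣p∣

∣q∣<∣p∣⇒∃∈p∉q : ∣ q ∣ < ∣ p ∣ → ∃ λ x → x ∈ p × x ∉ q
∣q∣<∣p∣⇒∃∈p∉q {q = q} {p = p} ∣q∣<∣p∣ with Finₚ.any? (λ x → x ∈? p ×-dec ¬? (x ∈? q))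
... | yes x∈p∖q = x∈p∖q
... | no ∄      = contradiction (p⊆q⇒∣p∣≤∣q∣ p⊆q) (ℕₚ.<⇒≱ ∣q∣<∣p∣)
  where
  p⊆q : p ⊆ q
  p⊆q {x} x∈p = decidable-stable (x ∈? q) λ x∉q → ∄ (x , x∈p , x∉q)

0<∣p∣⇒Nonempty : 0 < ∣ p ∣ → Nonempty p
0<∣p∣⇒Nonempty {n} {p} 0<∣p∣ with ∣q∣<∣p∣⇒∃∈p∉q {q = ⊥} (subst (_< ∣ p ∣) (sym (∣⊥∣≡0 n)) 0<∣p∣)
... | x , x∈p , _ = x , x∈p

∃⊆-of-size : ∀ m → m ≤ ∣ p ∣ → ∃ λ q → q ⊆ p × ∣ q ∣ ≡ m
∃⊆-of-size {n} {p} zero _ = ⊥ , ⊆-min p , ∣⊥∣≡0 n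
∃⊆-of-size {p = inside ∷ p} (suc m) m<∣p∣ with ∃⊆-of-size m (ℕₚ.≤-pred m<∣p∣)
... | q , q⊆p , ∣q∣≡m = inside ∷ q , in⊆in q⊆p , cong suc ∣q∣≡m
∃⊆-of-size {p = outside ∷ p} (suc m) m<∣p∣ with ∃⊆-of-size (suc m) m<∣p∣
... | q , q⊆p , ∣q∣≡m = outside ∷ q , out⊆ q⊆p , ∣q∣≡m

p⊆q∧x∉q⇒p∪⁅x⁆∩q≡p : p ⊆ q → x ∉ q → (p ∪ ⁅ x ⁆) ∩ q ≡ p
p⊆q∧x∉q⇒p∪⁅x⁆∩q≡p {p = p} {q = q} {x = x} p⊆q x∉q =
  ⊆-antisym ⊆p (λ y∈p → x∈p∩q⁺ (x∈p∪q⁺ (inj₁ y∈p) , p⊆q y∈p))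
  where
  ⊆p : (p ∪ ⁅ x ⁆) ∩ q ⊆ p
  ⊆p y∈ with x∈p∩q⁻ (p ∪ ⁅ x ⁆) q y∈
  ... | y∈p∪⁅x⁆ , y∈q with x∈p∪⁅y⁆⁻ y∈p∪⁅x⁆
  ...   | inj₁ y∈p  = y∈p
  ...   | inj₂ refl = contradiction y∈q x∉q

∣p∣≡1+∣p∩q∣⇒p-x⊆q : ∣ p ∣ ≡ suc ∣ p ∩ q ∣ → ∃ λ x → x ∈ p × x ∉ q × p - x ⊆ q
∣p∣≡1+∣p∩q∣⇒p-x⊆q {p = p} {q = q} ∣p∣≡1+∣p∩q∣
  with ∣q∣<∣p∣⇒∃∈p∉q (ℕₚ.≤-reflexive (sym ∣p∣≡1+∣p∩q∣))
... | x , x∈p , x∉p∩q = x , x∈p , x∉p∩q ∘ (x∈p∩q⁺ ∘ (x∈p ,_)) , p-x⊆q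
  where
  p∩q⊆p-x : p ∩ q ⊆ p - x
  p∩q⊆p-x y∈p∩q = x∈p∧x≢y⇒x∈p-y (proj₁ (x∈p∩q⁻ p q y∈p∩q)) λ { refl → x∉p∩q y∈p∩q }
  p∩q≡p-x : p ∩ q ≡ p - x
  p∩q≡p-x = p⊆q∧∣q∣≤∣p∣⇒p≡q p∩q⊆p-x (ℕₚ.≤-reflexive (x∈p∧∣p∣≡1+k⇒∣p-x∣≡k x∈p ∣p∣≡1+∣p∩q∣))
  p-x⊆q : p - x ⊆ q
  p-x⊆q y∈p-x = proj₂ (x∈p∩q⁻ p q (subst (_ ∈_) (sym p∩q≡p-x) y∈p-x))

x∉q∧∣q∣≡n∸1⇒p∩q≡p-x : ∀ {n x} {p q : Subset n} → x ∉ q → ∣ q ∣ ≡ n ∸ 1 → p ∩ q ≡ p - x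
x∉q∧∣q∣≡n∸1⇒p∩q≡p-x {n} {x} {p} {q} x∉q ∣q∣≡n∸1 = ⊆-antisym
  (λ y∈p∩q → let y∈p , y∈q = x∈p∩q⁻ p q y∈p∩q in x∈p∧x≢y⇒x∈p-y y∈p λ { refl → x∉q y∈q })
  (λ y∈p-x → x∈p∩q⁺ (x∈p-y⇒x∈p y∈p-x , ≢x⇒∈q (x∈p-y⇒x≢y y∈p-x)))
  where
  q≡∁⁅x⁆ : q ≡ ∁ ⁅ x ⁆
  q≡∁⁅x⁆ = p⊆q∧∣q∣≤∣p∣⇒p≡q (λ y∈q → x∉p⇒x∈∁p (x≢y⇒x∉⁅y⁆ λ { refl → x∉q y∈q }))
    (ℕₚ.≤-reflexive (trans (∣∁p∣≡n∸∣p∣ ⁅ x ⁆) (trans (cong (n ∸_) (∣⁅x⁆∣≡1 x)) (sym ∣q∣≡n∸1))))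
  ≢x⇒∈q : ∀ {y} → y ≢ x → y ∈ q
  ≢x⇒∈q y≢x = subst (_ ∈_) (sym q≡∁⁅x⁆) (x∉p⇒x∈∁p (x≢y⇒x∉⁅y⁆ y≢x))

image : (Fin k → Fin n) → Subset n
image {zero}  c = ⊥
image {suc k} c = image (tail c) ∪ ⁅ head c ⁆

∈-image⁺ : (c : Fin k → Fin n) (i : Fin k) → c i ∈ image c
∈-image⁺ c zero    = x∈p∪q⁺ (inj₂ (x∈⁅x⁆ (c zero)))
∈-image⁺ c (suc i) = x∈p∪q⁺ (inj₁ (∈-image⁺ (tail c) i))

∈-image⁻ : (c : Fin k → Fin n) → y ∈ image c → ∃ λ i → c i ≡ y
∈-image⁻ {zero}  c y∈ = contradiction y∈ ∉⊥
∈-image⁻ {suc k} c y∈ with x∈p∪⁅y⁆⁻ y∈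
... | inj₂ y≡c₀ = zero , sym y≡c₀
... | inj₁ y∈image-tail with ∈-image⁻ (tail c) y∈image-tail
...   | i , cᵢ≡y = suc i , cᵢ≡y

image-⊆ : (c : Fin k → Fin n) → (∀ i → c i ∈ p) → image c ⊆ p
image-⊆ c c∈p y∈ with ∈-image⁻ c y∈
... | i , refl = c∈p i

head∉image-tail : (c : Fin (suc k) → Fin n) → Injective _≡_ _≡_ c → head c ∉ image (tail c)
head∉image-tail c c-inj c₀∈ with ∈-image⁻ (tail c) c₀∈
... | i , cᵢ≡c₀ with c-inj cᵢ≡c₀
... | ()

tail-injective : (c : Fin (suc k) → Fin n) → Injective _≡_ _≡_ c → Injective _≡_ _≡_ (tail c)
tail-injective c c-inj = Finₚ.suc-injective ∘ c-inj

∣image∣≡k : (c : Fin k → Fin n) → Injective _≡_ _≡_ c → ∣ image c ∣ ≡ k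
∣image∣≡k {zero}  {n} c _ = ∣⊥∣≡0 n
∣image∣≡k {suc k} c c-inj = trans (x∉p⇒∣p∪⁅x⁆∣≡1+∣p∣ (head∉image-tail c c-inj))
                                  (cong suc (∣image∣≡k (tail c) (tail-injective c c-inj)))

subsets : ∀ n → List (Subset n)
subsets zero    = [] ∷ []
subsets (suc n) = map (inside ∷_) (subsets n) ++ map (outside ∷_) (subsets n)

∈-subsets : (p : Subset n) → p ∈ₗ subsets n
∈-subsets []            = Any.here refl
∈-subsets (inside ∷ p)  = ∈-++⁺ˡ (∈-map⁺ (inside ∷_) (∈-subsets p))
∈-subsets (outside ∷ p) = ∈-++⁺ʳ _ (∈-map⁺ (outside ∷_) (∈-subsets p))

allSubsets? : {P : Subset n → Set} → Decidable P → Dec (∀ p → P p)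
allSubsets? P? with anySubset? (¬? ∘ P?)
... | yes (p , ¬Pp) = no λ ∀P → ¬Pp (∀P p)
... | no ∄¬P       = yes λ p → decidable-stable (P? p) λ ¬Pp → ∄¬P (p , ¬Pp)

module _ {m n} (M : BoolMatrix m n) where

  record IsTriangular {k} (r : Fin k → Fin m) (c : Fin k → Fin n) : Set where
    field
      diagonal : ∀ i → M (r i) (c i) ≡ true
      above    : ∀ {i j} → i Fin.< j → M (r i) (c j) ≡ false

  open IsTriangular

  module _ {r : Fin k → Fin m} {c : Fin k → Fin n} (t : IsTriangular r c) where

    triangular⇒rows-distinct : ∀ {i j} → i Fin.< j → r i ≢ r j
    triangular⇒rows-distinct {i} {j} i<j rᵢ≡rⱼ with
      trans (sym (diagonal t j)) (subst (λ ρ → M ρ (c j) ≡ false) rᵢ≡rⱼ (above t i<j))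
    ... | ()

    triangular⇒rows-injective : Injective _≡_ _≡_ r
    triangular⇒rows-injective {i} {j} rᵢ≡rⱼ with Finₚ.<-cmp i j
    ... | tri< i<j _ _ = contradiction rᵢ≡rⱼ (triangular⇒rows-distinct i<j)
    ... | tri≈ _ i≡j _ = i≡j
    ... | tri> _ _ j<i = contradiction (sym rᵢ≡rⱼ) (triangular⇒rows-distinct j<i)

  tail-triangular : {r : Fin (suc k) → Fin m} {c : Fin (suc k) → Fin n} →
                    IsTriangular r c → IsTriangular (tail r) (tail c)
  tail-triangular t = record { diagonal = diagonal t ∘ suc ; above = above t ∘ s<s }

  ∷-triangular : ∀ {ρ x} {r : Fin k → Fin m} {c : Fin k → Fin n} →
                 IsTriangular r c → M ρ x ≡ true → (∀ i → M ρ (c i) ≡ false) →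
                 IsTriangular (ρ Vector.∷ r) (x Vector.∷ c)
  ∷-triangular {k} {ρ} {x} {r} {c} t ρx≡true ρc≡false = record { diagonal = diag ; above = abv }
    where
    diag : ∀ i → M ((ρ Vector.∷ r) i) ((x Vector.∷ c) i) ≡ true
    diag zero    = ρx≡true
    diag (suc i) = diagonal t i
    abv : ∀ {i j : Fin (suc k)} → i Fin.< j → M ((ρ Vector.∷ r) i) ((x Vector.∷ c) j) ≡ false
    abv {zero}  {suc j} _   = ρc≡false j
    abv {suc i} {suc j} i<j = above t (s<s⁻¹ i<j)

  ∷-injective : ∀ {x} {c : Fin k → Fin n} → Injective _≡_ _≡_ c → x ∉ image c →
                Injective _≡_ _≡_ (x Vector.∷ c)
  ∷-injective         _     _  {zero}  {zero}  _     = refl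
  ∷-injective {c = c} _     x∉ {zero}  {suc j} x≡cⱼ  =
    contradiction (subst (_∈ image c) (sym x≡cⱼ) (∈-image⁺ c j)) x∉
  ∷-injective {c = c} _     x∉ {suc i} {zero}  cᵢ≡x  =
    contradiction (subst (_∈ image c) cᵢ≡x (∈-image⁺ c i)) x∉
  ∷-injective         c-inj _  {suc i} {suc j} cᵢ≡cⱼ = cong suc (c-inj cᵢ≡cⱼ)

  record TriangularCols (X : Subset n) : Set where
    field
      size           : ℕ
      rows           : Fin size → Fin m
      cols           : Fin size → Fin n
      cols-injective : Injective _≡_ _≡_ cols
      image-cols     : image cols ≡ X
      triangular     : IsTriangular rows cols

  triangularCols⇔ : ∀ {X} → TriangularCols X ⇔ LowerUnitriangularCols M X
  triangularCols⇔ {X} = mk⇔ to from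
    where
    to : TriangularCols X → LowerUnitriangularCols M X
    to t = size , rows , cols , triangular⇒rows-injective triangular , cols-injective
         , (λ x → mk⇔ (∈-image⁻ cols ∘ subst (x ∈_) (sym image-cols))
                      λ { (i , refl) → subst (cols i ∈_) image-cols (∈-image⁺ cols i) })
         , diagonal triangular , λ _ _ → above triangular
      where open TriangularCols t
    from : LowerUnitriangularCols M X → TriangularCols X
    from (k , r , c , _ , c-inj , X⇔ , diag , abv) = record
      { size = k ; rows = r ; cols = c ; cols-injective = c-inj
      ; image-cols = ⊆-antisym (image-⊆ c λ i → Equivalence.from (X⇔ (c i)) (i , refl)) X⊆image
      ; triangular = record { diagonal = diag ; above = abv _ _ }
      }
      where
      X⊆image : X ⊆ image c
      X⊆image {x} x∈X with Equivalence.to (X⇔ x) x∈X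
      ... | i , refl = ∈-image⁺ c i

  ⊥-triangularCols : TriangularCols ⊥
  ⊥-triangularCols = record
    { size = 0 ; rows = λ () ; cols = λ () ; cols-injective = λ { {()} } ; image-cols = refl
    ; triangular = record { diagonal = λ () ; above = λ { {()} } }
    }

  ∪⁅⁆-triangularCols : ∀ {Y x ρ} → TriangularCols Y → x ∉ Y → M ρ x ≡ true →
                       (∀ {y} → y ∈ Y → M ρ y ≡ false) → TriangularCols (Y ∪ ⁅ x ⁆)
  ∪⁅⁆-triangularCols {Y} {x} {ρ} t x∉Y ρx≡true ρY≡false = record
    { size           = suc size
    ; rows           = ρ Vector.∷ rows
    ; cols           = x Vector.∷ cols
    ; cols-injective = ∷-injective cols-injective (subst (x ∉_) (sym image-cols) x∉Y)
    ; image-cols     = cong (_∪ ⁅ x ⁆) image-cols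
    ; triangular     = ∷-triangular triangular ρx≡true λ i →
                         ρY≡false (subst (cols i ∈_) image-cols (∈-image⁺ cols i))
    }
    where open TriangularCols t

module FlatRepresentation {n} (d : ℕ) (H : Subset n → Set) (H? : Decidable H) where

  DClosed : Subset n → Set
  DClosed Z = ∀ Y → Y ⊆ Z → ∣ Y ∣ ≡ d → ∀ w → w ∉ Z → H (Y ∪ ⁅ w ⁆)

  TopFaceFree : Subset n → Set
  TopFaceFree Z = ∀ W → W ⊆ Z → ∣ W ∣ ≡ suc d → ¬ H W

  -- When H consists of P_{≤d}(V) and some (d+1)-sets, a proper subset of V is
  -- flat in this sense exactly when it is a flat (closed set) of H.
  Flat : Subset n → Set
  Flat Z = DClosed Z × TopFaceFree Z

  flat? : Decidable Flat
  flat? Z =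
    allSubsets? (λ Y → Y ⊆? Z →-dec (∣ Y ∣ ℕₚ.≟ d →-dec
                  Finₚ.all? λ w → ¬? (w ∈? Z) →-dec H? (Y ∪ ⁅ w ⁆)))
    ×-dec allSubsets? (λ W → W ⊆? Z →-dec (∣ W ∣ ℕₚ.≟ suc d →-dec ¬? (H? W)))

  ∣Z∣≤d⇒topFaceFree : ∀ {Z} → ∣ Z ∣ ≤ d → TopFaceFree Z
  ∣Z∣≤d⇒topFaceFree ∣Z∣≤d W W⊆Z ∣W∣≡1+d _ =
    ℕₚ.<⇒≱ (subst (d <_) (sym ∣W∣≡1+d) ℕₚ.≤-refl) (ℕₚ.≤-trans (p⊆q⇒∣p∣≤∣q∣ W⊆Z) ∣Z∣≤d)

  ∣Z∣<d⇒flat : ∀ {Z} → ∣ Z ∣ < d → Flat Z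
  ∣Z∣<d⇒flat {Z} ∣Z∣<d = dClosed , ∣Z∣≤d⇒topFaceFree (ℕₚ.<⇒≤ ∣Z∣<d)
    where
    dClosed : DClosed Z
    dClosed Y Y⊆Z ∣Y∣≡d _ _ =
      contradiction (subst (_≤ ∣ Z ∣) ∣Y∣≡d (p⊆q⇒∣p∣≤∣q∣ Y⊆Z)) (ℕₚ.<⇒≱ ∣Z∣<d)

  ∣Z∣≡d⇒flat : ∀ {Z} → ∣ Z ∣ ≡ d → (∀ w → w ∉ Z → H (Z ∪ ⁅ w ⁆)) → Flat Z
  ∣Z∣≡d⇒flat {Z} ∣Z∣≡d H[Z∪w] = dClosed , ∣Z∣≤d⇒topFaceFree (ℕₚ.≤-reflexive ∣Z∣≡d)
    where
    dClosed : DClosed Z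
    dClosed Y Y⊆Z ∣Y∣≡d w w∉Z = subst (λ Y → H (Y ∪ ⁅ w ⁆)) (sym Y≡Z) (H[Z∪w] w w∉Z)
      where Y≡Z = p⊆q∧∣q∣≤∣p∣⇒p≡q Y⊆Z (ℕₚ.≤-reflexive (trans ∣Z∣≡d (sym ∣Y∣≡d)))

  FlatSeparated : Subset n → Set
  FlatSeparated X = ∃₂ λ x Z → Flat Z × x ∈ X × x ∉ Z × X - x ⊆ Z

  rowCount : ℕ
  rowCount = length (subsets n)

  rowSet : Fin rowCount → Subset n
  rowSet = lookup (subsets n)

  rowOf : Subset n → Fin rowCount
  rowOf Z = Any.index (∈-subsets Z)

  rowSet∘rowOf : ∀ Z → rowSet (rowOf Z) ≡ Z
  rowSet∘rowOf Z = sym (lookup-index (∈-subsets Z))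

  flat∋? : ∀ ρ v → Dec (Flat (rowSet ρ) × v ∈ rowSet ρ)
  flat∋? ρ v = flat? (rowSet ρ) ×-dec v ∈? rowSet ρ

  -- A row whose set is not flat is constantly true, so it can only serve as the
  -- last row of a triangle.
  M : BoolMatrix rowCount n
  M ρ v = does (¬? (flat∋? ρ v))

  M≡false⇒flat-∈ : ∀ {ρ v} → M ρ v ≡ false → Flat (rowSet ρ) × v ∈ rowSet ρ
  M≡false⇒flat-∈ {ρ} {v} Mρv≡false = decidable-stable (flat∋? ρ v) λ ¬flat-∈ →
    contradiction (trans (sym (dec-true (¬? (flat∋? ρ v)) ¬flat-∈)) Mρv≡false) λ ()

  M≡true∧flat⇒∉ : ∀ {ρ v} → M ρ v ≡ true → Flat (rowSet ρ) → v ∉ rowSet ρ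
  M≡true∧flat⇒∉ {ρ} {v} Mρv≡true flat v∈ = contradiction
    (trans (sym Mρv≡true) (dec-false (¬? (flat∋? ρ v)) λ ¬flat-∈ → ¬flat-∈ (flat , v∈))) λ ()

  M-rowOf-∉ : ∀ {Z v} → v ∉ Z → M (rowOf Z) v ≡ true
  M-rowOf-∉ {Z} {v} v∉Z =
    dec-true (¬? (flat∋? (rowOf Z) v)) λ (_ , v∈) → v∉Z (subst (v ∈_) (rowSet∘rowOf Z) v∈)

  M-rowOf-∈ : ∀ {Z v} → Flat Z → v ∈ Z → M (rowOf Z) v ≡ false
  M-rowOf-∈ {Z} {v} flat v∈Z = dec-false (¬? (flat∋? (rowOf Z) v)) λ ¬flat-∈ →
    ¬flat-∈ (subst Flat (sym (rowSet∘rowOf Z)) flat , subst (v ∈_) (sym (rowSet∘rowOf Z)) v∈Z)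

  ∪⁅⁆-triangularCols-by-flat : ∀ {Y Z x} → TriangularCols M Y → Flat Z → x ∉ Z → Y ⊆ Z →
                               TriangularCols M (Y ∪ ⁅ x ⁆)
  ∪⁅⁆-triangularCols-by-flat t flat x∉Z Y⊆Z =
    ∪⁅⁆-triangularCols M t (x∉Z ∘ Y⊆Z) (M-rowOf-∉ x∉Z) (M-rowOf-∈ flat ∘ Y⊆Z)

  small-triangularCols : ∀ {X} → ∣ X ∣ ≤ d → TriangularCols M X
  small-triangularCols {X} ∣X∣≤d = build ∣ X ∣ X refl ∣X∣≤d
    where
    build : ∀ s X → ∣ X ∣ ≡ s → s ≤ d → TriangularCols M X
    build zero X ∣X∣≡0 _ = subst (TriangularCols M) ⊥≡X (⊥-triangularCols M)
      where ⊥≡X = p⊆q∧∣q∣≤∣p∣⇒p≡q (⊆-min X) (ℕₚ.≤-reflexive (trans ∣X∣≡0 (sym (∣⊥∣≡0 n))))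
    build (suc s) X ∣X∣≡1+s 1+s≤d with 0<∣p∣⇒Nonempty (subst (0 <_) (sym ∣X∣≡1+s) (s≤s z≤n))
    ... | x , x∈X = subst (TriangularCols M) (x∈p⇒p-x∪⁅x⁆≡p x∈X)
      (∪⁅⁆-triangularCols-by-flat (build s (X - x) ∣X-x∣≡s (ℕₚ.<⇒≤ 1+s≤d))
        (∣Z∣<d⇒flat (subst (_< d) (sym ∣X-x∣≡s) 1+s≤d)) (x∉p-x X x) ⊆-refl)
      where ∣X-x∣≡s = x∈p∧∣p∣≡1+k⇒∣p-x∣≡k x∈X ∣X∣≡1+s

  separated-triangularCols : ∀ {X} → ∣ X ∣ ≡ suc d → FlatSeparated X → TriangularCols M X
  separated-triangularCols ∣X∣≡1+d (x , Z , flat , x∈X , x∉Z , X-x⊆Z) =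
    subst (TriangularCols M) (x∈p⇒p-x∪⁅x⁆≡p x∈X)
      (∪⁅⁆-triangularCols-by-flat (small-triangularCols ∣X-x∣≤d) flat x∉Z X-x⊆Z)
    where ∣X-x∣≤d = ℕₚ.≤-reflexive (x∈p∧∣p∣≡1+k⇒∣p-x∣≡k x∈X ∣X∣≡1+d)

  module _ {r : Fin (suc k) → Fin rowCount} {c : Fin (suc k) → Fin n} (t : IsTriangular M r c) where

    open IsTriangular t

    headRow-∋ : ∀ j → Flat (rowSet (head r)) × tail c j ∈ rowSet (head r)
    headRow-∋ j = M≡false⇒flat-∈ {head r} {tail c j} (above {zero} {suc j} (s≤s z≤n))

    image-tail⊆headRow : image (tail c) ⊆ rowSet (head r)
    image-tail⊆headRow = image-⊆ (tail c) (proj₂ ∘ headRow-∋)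

    headFace : 0 < d → ∀ {Y} → Y ⊆ image (tail c) → ∣ Y ∣ ≡ d → H (Y ∪ ⁅ head c ⁆)
    headFace 0<d {Y} Y⊆ ∣Y∣≡d with 0<∣p∣⇒Nonempty (subst (0 <_) (sym ∣Y∣≡d) 0<d)
    ... | y , y∈Y with ∈-image⁻ (tail c) (Y⊆ y∈Y)
    ...   | j , _ = proj₁ flat Y (⊆-trans Y⊆ image-tail⊆headRow) ∣Y∣≡d (head c)
                      (M≡true∧flat⇒∉ (diagonal zero) flat)
      where flat = proj₁ (headRow-∋ j)

  module _ (0<d : 0 < d) where

    no-long-triangle : {r : Fin (suc (suc k)) → Fin rowCount} {c : Fin (suc (suc k)) → Fin n} →
                       Injective _≡_ _≡_ c → IsTriangular M r c → ¬ (d ≤ k)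
    no-long-triangle {k} {r} {c} c-inj t d≤k
      with ∃⊆-of-size {p = image (tail (tail c))} d (subst (d ≤_) (sym ∣image∣) d≤k)
      where ∣image∣ = ∣image∣≡k (tail (tail c)) (tail-injective (tail c) (tail-injective c c-inj))
    ... | Y , Y⊆ , ∣Y∣≡d =
      proj₂ (proj₁ (headRow-∋ t zero)) W W⊆headRow ∣W∣≡1+d
        (headFace (tail-triangular M t) 0<d Y⊆ ∣Y∣≡d)
      where
      W = Y ∪ ⁅ c (suc zero) ⁆
      W⊆headRow : W ⊆ rowSet (head r)
      W⊆headRow = ⊆-trans (p⊆q∧x∈q⇒p∪⁅x⁆⊆q (⊆-trans Y⊆ (p⊆p∪q _)) (x∈p∪q⁺ (inj₂ (x∈⁅x⁆ _))))
                          (image-tail⊆headRow t)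
      ∣W∣≡1+d : ∣ W ∣ ≡ suc d
      ∣W∣≡1+d = trans (x∉p⇒∣p∪⁅x⁆∣≡1+∣p∣ (head∉image-tail (tail c) (tail-injective c c-inj) ∘ Y⊆))
                      (cong suc ∣Y∣≡d)

    module _ (small-faces : ∀ X → ∣ X ∣ ≤ d → H X) where

      triangle-face : {r : Fin k → Fin rowCount} {c : Fin k → Fin n} →
                      Injective _≡_ _≡_ c → IsTriangular M r c → H (image c)
      triangle-face {k} {r} {c} c-inj t with ℕₚ.<-cmp k (suc d)
      ... | tri< k<1+d _ _ =
        small-faces (image c) (subst (_≤ d) (sym (∣image∣≡k c c-inj)) (ℕₚ.≤-pred k<1+d))
      ... | tri≈ _ refl _ = headFace t 0<d ⊆-refl (∣image∣≡k (tail c) (tail-injective c c-inj))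
      ... | tri> _ _ (s≤s (s≤s d≤k)) = contradiction d≤k (no-long-triangle c-inj t)

      flatRepresentable : (∀ X → H X → ∣ X ∣ ≤ d ⊎ ∣ X ∣ ≡ suc d × FlatSeparated X) →
                          BooleanRepresentable H
      flatRepresentable faces = rowCount , M , λ X → mk⇔ (to X) (from X)
        where
        to : ∀ X → H X → LowerUnitriangularCols M X
        to X HX with faces X HX
        ... | inj₁ ∣X∣≤d = Equivalence.to (triangularCols⇔ M) (small-triangularCols ∣X∣≤d)
        ... | inj₂ (∣X∣≡1+d , sep) =
          Equivalence.to (triangularCols⇔ M) (separated-triangularCols ∣X∣≡1+d sep)
        from : ∀ X → LowerUnitriangularCols M X → H X
        from X lut = subst H image-cols (triangle-face cols-injective triangular)
          where open TriangularCols (Equivalence.from (triangularCols⇔ M) lut)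

module UnionOfB (d : ℕ) {n} (𝓛 : List (Subset n)) where

  B? : (L X : Subset n) → Dec (B d L X)
  B? L X = ∣ X ∣ ≤? d ⊎-dec (∣ X ∣ ℕₚ.≟ d + 1 ×-dec ∣ X ∩ L ∣ ℕₚ.≟ d)

  ⋃B? : Decidable (⋃B d 𝓛)
  ⋃B? X = map′ find (λ (_ , L∈𝓛 , BLX) → lose L∈𝓛 BLX) (Any.any? (λ L → B? L X) 𝓛)

  open FlatRepresentation d (⋃B d 𝓛) ⋃B? public

  1+d≡d+1 : suc d ≡ d + 1
  1+d≡d+1 = ℕₚ.+-comm 1 d

  member-dClosed : ∀ {L} → L ∈ₗ 𝓛 → DClosed L
  member-dClosed L∈𝓛 Y Y⊆L ∣Y∣≡d w w∉L =
    _ , L∈𝓛 , inj₂ ( trans (x∉p⇒∣p∪⁅x⁆∣≡1+∣p∣ (w∉L ∘ Y⊆L)) (trans (cong suc ∣Y∣≡d) 1+d≡d+1)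
                   , trans (cong ∣_∣ (p⊆q∧x∉q⇒p∪⁅x⁆∩q≡p Y⊆L w∉L)) ∣Y∣≡d )

  module _ {L X x} (L∈𝓛 : L ∈ₗ 𝓛) (x∈X : x ∈ X) (x∉L : x ∉ L) (X-x⊆L : X - x ⊆ L) where

    separated-∣L∣≡d : ∣ L ∣ ≡ d → FlatSeparated X
    separated-∣L∣≡d ∣L∣≡d =
      x , L , (member-dClosed L∈𝓛 , ∣Z∣≤d⇒topFaceFree (ℕₚ.≤-reflexive ∣L∣≡d)) , x∈X , x∉L , X-x⊆L

    separated-∣L∣≡1+d : ∣ X ∣ ≡ suc d → ∣ L ∣ ≡ suc d → FlatSeparated X
    separated-∣L∣≡1+d ∣X∣≡1+d ∣L∣≡1+d with ⋃B? L
    ... | no ¬HL = x , L , (member-dClosed L∈𝓛 , topFaceFree) , x∈X , x∉L , X-x⊆L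
      where
      topFaceFree : TopFaceFree L
      topFaceFree W W⊆L ∣W∣≡1+d = subst (¬_ ∘ ⋃B d 𝓛) (sym W≡L) ¬HL
        where W≡L = p⊆q∧∣q∣≤∣p∣⇒p≡q W⊆L (ℕₚ.≤-reflexive (trans ∣L∣≡1+d (sym ∣W∣≡1+d)))
    ... | yes HL with ∣q∣<∣p∣⇒∃∈p∉q {q = X - x} {p = L}
                        (subst₂ _<_ (sym (x∈p∧∣p∣≡1+k⇒∣p-x∣≡k x∈X ∣X∣≡1+d)) (sym ∣L∣≡1+d) ℕₚ.≤-refl)
    ...   | a , a∈L , a∉X-x =
      x , L - a , ∣Z∣≡d⇒flat ∣L-a∣≡d H[L-a∪w] , x∈X , x∉L ∘ x∈p-y⇒x∈p , X-x⊆L-a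
      where
      ∣L-a∣≡d : ∣ L - a ∣ ≡ d
      ∣L-a∣≡d = x∈p∧∣p∣≡1+k⇒∣p-x∣≡k a∈L ∣L∣≡1+d
      H[L-a∪w] : ∀ w → w ∉ L - a → ⋃B d 𝓛 ((L - a) ∪ ⁅ w ⁆)
      H[L-a∪w] w w∉L-a with w Finₚ.≟ a
      ... | yes refl = subst (⋃B d 𝓛) (sym (x∈p⇒p-x∪⁅x⁆≡p a∈L)) HL
      ... | no w≢a   = member-dClosed L∈𝓛 (L - a) (p─q⊆p L ⁅ a ⁆) ∣L-a∣≡d w
                         λ w∈L → w∉L-a (x∈p∧x≢y⇒x∈p-y w∈L w≢a)
      X-x⊆L-a : X - x ⊆ L - a
      X-x⊆L-a y∈X-x = x∈p∧x≢y⇒x∈p-y (X-x⊆L y∈X-x) λ { refl → a∉X-x y∈X-x }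

    separated-∣L∣≡n∸1 : 0 < d → ∣ X ∣ ≡ suc d → ∣ L ∣ ≡ n ∸ 1 → FlatSeparated X
    separated-∣L∣≡n∸1 0<d ∣X∣≡1+d ∣L∣≡n∸1 with 0<∣p∣⇒Nonempty (subst (0 <_) (sym ∣X-x∣≡d) 0<d)
      where ∣X-x∣≡d = x∈p∧∣p∣≡1+k⇒∣p-x∣≡k x∈X ∣X∣≡1+d
    ... | y , y∈X-x = y , X - y , ∣Z∣≡d⇒flat ∣X-y∣≡d H[X-y∪w] , x∈p-y⇒x∈p y∈X-x , x∉p-x X y , ⊆-refl
      where
      ∣X-y∣≡d : ∣ X - y ∣ ≡ d
      ∣X-y∣≡d = x∈p∧∣p∣≡1+k⇒∣p-x∣≡k (x∈p-y⇒x∈p y∈X-x) ∣X∣≡1+d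
      H[X-y∪w] : ∀ w → w ∉ X - y → ⋃B d 𝓛 ((X - y) ∪ ⁅ w ⁆)
      H[X-y∪w] w w∉X-y = _ , L∈𝓛 , inj₂ (trans ∣W∣≡1+d 1+d≡d+1 , ∣W∩L∣≡d)
        where
        W = (X - y) ∪ ⁅ w ⁆
        ∣W∣≡1+d : ∣ W ∣ ≡ suc d
        ∣W∣≡1+d = trans (x∉p⇒∣p∪⁅x⁆∣≡1+∣p∣ w∉X-y) (cong suc ∣X-y∣≡d)
        x∈W : x ∈ W
        x∈W = x∈p∪q⁺ (inj₁ (x∈p∧x≢y⇒x∈p-y x∈X λ { refl → x∉p-x X x y∈X-x }))
        ∣W∩L∣≡d : ∣ W ∩ L ∣ ≡ d
        ∣W∩L∣≡d = trans (cong ∣_∣ (x∉q∧∣q∣≡n∸1⇒p∩q≡p-x {p = W} x∉L ∣L∣≡n∸1))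
                        (x∈p∧∣p∣≡1+k⇒∣p-x∣≡k x∈W ∣W∣≡1+d)

  ⋃B-small : ∀ {L} → L ∈ₗ 𝓛 → ∀ X → ∣ X ∣ ≤ d → ⋃B d 𝓛 X
  ⋃B-small L∈𝓛 X ∣X∣≤d = _ , L∈𝓛 , inj₁ ∣X∣≤d

  ⋃B-faces : 0 < d → (∀ L → L ∈ₗ 𝓛 → ∣ L ∣ ≡ d ⊎ ∣ L ∣ ≡ d + 1 ⊎ ∣ L ∣ ≡ n ∸ 1) →
             ∀ X → ⋃B d 𝓛 X → ∣ X ∣ ≤ d ⊎ ∣ X ∣ ≡ suc d × FlatSeparated X
  ⋃B-faces _ _ X (_ , _ , inj₁ ∣X∣≤d) = inj₁ ∣X∣≤d
  ⋃B-faces 0<d sizes X (L , L∈𝓛 , inj₂ (∣X∣≡d+1 , ∣X∩L∣≡d))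
    with ∣p∣≡1+∣p∩q∣⇒p-x⊆q {p = X} {q = L}
           (trans ∣X∣≡d+1 (trans (sym 1+d≡d+1) (cong suc (sym ∣X∩L∣≡d))))
  ... | x , x∈X , x∉L , X-x⊆L = inj₂ (∣X∣≡1+d , separated (sizes L L∈𝓛))
    where
    ∣X∣≡1+d : ∣ X ∣ ≡ suc d
    ∣X∣≡1+d = trans ∣X∣≡d+1 (sym 1+d≡d+1)
    separated : ∣ L ∣ ≡ d ⊎ ∣ L ∣ ≡ d + 1 ⊎ ∣ L ∣ ≡ n ∸ 1 → FlatSeparated X
    separated (inj₁ ∣L∣≡d)          = separated-∣L∣≡d L∈𝓛 x∈X x∉L X-x⊆L ∣L∣≡d
    separated (inj₂ (inj₁ ∣L∣≡d+1)) =
      separated-∣L∣≡1+d L∈𝓛 x∈X x∉L X-x⊆L ∣X∣≡1+d (trans ∣L∣≡d+1 (sym 1+d≡d+1))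
    separated (inj₂ (inj₂ ∣L∣≡n∸1)) = separated-∣L∣≡n∸1 L∈𝓛 x∈X x∉L X-x⊆L 0<d ∣X∣≡1+d ∣L∣≡n∸1

corollary5p9 : (d n : ℕ) → 2 ≤ d → d + 1 ≤ n → (𝓛 : List (Subset n)) → 𝓛 ≢ [] →
    (∀ L → L ∈ₗ 𝓛 → ∣ L ∣ ≡ d ⊎ ∣ L ∣ ≡ d + 1 ⊎ ∣ L ∣ ≡ n ∸ 1) →
    BooleanRepresentable (⋃B d 𝓛)
corollary5p9 d n 2≤d _ []      []≢[] _     = contradiction refl []≢[]
corollary5p9 d n 2≤d _ (L ∷ 𝓛) _     sizes =
  flatRepresentable 0<d (⋃B-small (Any.here refl)) (⋃B-faces 0<d sizes)
  where
  open UnionOfB d (L ∷ 𝓛)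
  0<d : 0 < d
  0<d = ℕₚ.<-≤-trans (s≤s z≤n) 2≤d
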